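{- For every $G\in\mathbb{Np}^\infty$, with $0=\{\overline\infty\mid\infty\}$: $G\succ 0$ iff $o(G)=\mathscr L$; $G=0$ iff $o(G)=\mathscr P$; $G$ is incomparable with $0$ iff $o(G)=\mathscr N$; $G\prec 0$ iff $o(G)=\mathscr R$.
   Context: Affine normal play forms $\mathbb{Np}^\infty$ are defined recursively: two atomic forms $\infty$ and $\overline{\infty}$ with no options; every other form is $G=\{G^{\mathcal L}\mid G^{\mathcal R}\}$ with finite nonempty sets of previously constructed forms as Left and Right options. Disjunctive sum: $\infty+X=X+\infty=\infty$ for $X\neq\overline{\infty}$; $\overline{\infty}+X=X+\overline{\infty}=\overline{\infty}$ for $X\ne\infty$; $\infty+\overline{\infty}$ undefined; otherwise $G+H=\{G^L+H,G+H^L\mid G^R+H,G+H^R\}$. Outcomes: Left wins $\infty$ and Right wins $\overline{\infty}$ whoever moves; otherwise play alternates, Left moving first wins iff some Left option is won by Left moving second, Left moving second wins iff every Right option is won by Left moving first, symmetrically for Right. $o(G)$ is $\mathscr L$ (Left wins moving first and second), $\mathscr R$ (Right wins either way), $\mathscr N$ (first player wins), $\mathscr P$ (second player wins), partially ordered by $\mathscr L>\mathscr N>\mathscr R$, $\mathscr L>\mathscr P>\mathscr R$, with $\mathscr N,\mathscr P$ incomparable. $G\succcurlyeq H$ means $o(G+X)\geqslant o(H+X)$ for every $X\in\mathbb{Np}^\infty\setminus\{\infty,\overline\infty\}$; $G=H$ means $G\succcurlyeq H$ and $H\succcurlyeq G$; $G\succ H$ means $G\succcurlyeq H$ and not $H\succcurlyeq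 G$; $G\prec H$ means $H\succ G$; incomparable means neither $G\succcurlyeq H$ nor $H\succcurlyeq G$. -}

module Defs where

open import Data.Bool using (Bool; true; false; _∧_; _∨_; not)
open import Data.Product using (_×_)
open import Relation.Nullary using (¬_)
open import Relation.Binary.PropositionalEquality using (_≡_)

-- Affine normal play forms Np^∞.  Finite nonempty option sets are
-- represented by nonempty lists `Opts` (order/duplicates are irrelevant
-- to every notion below).
infixr 5 _∷_
mutual
  data Form : Set where
    ∞   : Form                          -- Left wins
    ∞̄   : Form                          -- Right wins
    ⟨_∣_⟩ : Opts → Opts → Form

  data Opts : Set where
    [_] : Form → Opts
    _∷_ : Form → Opts → Opts

_++_ : Opts → Opts → Opts
[ x ] ++ ys = x ∷ ys
(x ∷ xs) ++ ys = x ∷ (xs ++ ys)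

NonAtomic : Form → Set
NonAtomic ∞ = Data.Empty.⊥ where import Data.Empty
NonAtomic ∞̄ = Data.Empty.⊥ where import Data.Empty
NonAtomic ⟨ _ ∣ _ ⟩ = Data.Unit.⊤ where import Data.Unit

-- Disjunctive sum.  ∞ + ∞̄ is undefined in the paper; here it is given
-- the arbitrary value ∞.  This case never arises in the
-- statement: sums are only formed as G + X with X non-atomic, and all
-- recursive calls keep one summand non-atomic.
mutual
  _+_ : Form → Form → Form
  ∞ + _ = ∞
  ∞̄ + ∞ = ∞
  ∞̄ + _ = ∞̄
  ⟨ GL ∣ GR ⟩ + ∞ = ∞
  ⟨ GL ∣ GR ⟩ + ∞̄ = ∞̄
  ⟨ GL ∣ GR ⟩ + ⟨ HL ∣ HR ⟩ =
    ⟨ addˡ GL ⟨ HL ∣ HR ⟩ ++ addʳ ⟨ GL ∣ GR ⟩ HL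
    ∣ addˡ GR ⟨ HL ∣ HR ⟩ ++ addʳ ⟨ GL ∣ GR ⟩ HR ⟩

  addˡ : Opts → Form → Opts
  addˡ [ g ] H = [ g + H ]
  addˡ (g ∷ gs) H = (g + H) ∷ (addˡ gs H)

  addʳ : Form → Opts → Opts
  addʳ G [ h ] = [ G + h ]
  addʳ G (h ∷ hs) = (G + h) ∷ (addʳ G hs)

mutual
  leftFirst : Form → Bool
  leftFirst ∞ = true
  leftFirst ∞̄ = false
  leftFirst ⟨ GL ∣ GR ⟩ = anyLeftSecond GL

  leftSecond : Form → Bool
  leftSecond ∞ = true
  leftSecond ∞̄ = false
  leftSecond ⟨ GL ∣ GR ⟩ = allLeftFirst GR

  anyLeftSecond : Opts → Bool
  anyLeftSecond [ g ] = leftSecond g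
  anyLeftSecond (g ∷ gs) = leftSecond g ∨ anyLeftSecond gs

  allLeftFirst : Opts → Bool
  allLeftFirst [ g ] = leftFirst g
  allLeftFirst (g ∷ gs) = leftFirst g ∧ allLeftFirst gs

mutual
  rightFirst : Form → Bool
  rightFirst ∞ = false
  rightFirst ∞̄ = true
  rightFirst ⟨ GL ∣ GR ⟩ = anyRightSecond GR

  rightSecond : Form → Bool
  rightSecond ∞ = false
  rightSecond ∞̄ = true
  rightSecond ⟨ GL ∣ GR ⟩ = allRightFirst GL

  anyRightSecond : Opts → Bool
  anyRightSecond [ g ] = rightSecond g
  anyRightSecond (g ∷ gs) = rightSecond g ∨ anyRightSecond gs

  allRightFirst : Opts → Bool
  allRightFirst [ g ] = rightFirst g
  allRightFirst (g ∷ gs) = rightFirst g ∧ allRightFirst gs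

data Outcome : Set where
  𝓛 𝓝 𝓟 𝓡 : Outcome

outcomeFrom : Bool → Bool → Bool → Bool → Outcome
outcomeFrom true  true  _     _     = 𝓛
outcomeFrom _     _     true  true  = 𝓡
outcomeFrom true  _     true  _     = 𝓝
outcomeFrom _     _     _     _     = 𝓟

o : Form → Outcome
o G = outcomeFrom (leftFirst G) (leftSecond G) (rightFirst G) (rightSecond G)

data _≤ₒ_ : Outcome → Outcome → Set where
  refl≤ : ∀ {a} → a ≤ₒ a
  𝓡≤ : ∀ {a} → 𝓡 ≤ₒ a
  ≤𝓛 : ∀ {a} → a ≤ₒ 𝓛

_≽_ : Form → Form → Set
G ≽ H = (X : Form) → NonAtomic X → o (H + X) ≤ₒ o (G + X)

_≈_ : Form → Form → Set
G ≈ H = (G ≽ H) × (H ≽ G)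

_≻_ : Form → Form → Set
G ≻ H = (G ≽ H) × ¬ (H ≽ G)

_≺_ : Form → Form → Set
G ≺ H = H ≻ G

_‖_ : Form → Form → Set
G ‖ H = ¬ (G ≽ H) × ¬ (H ≽ G)

𝟘 : Form
𝟘 = ⟨ [ ∞̄ ] ∣ [ ∞ ] ⟩

module Submission where

-- By determinacy, o G is a function of whether Left wins G moving first and
-- moving second, and adding 𝟘 changes neither.  If Left wins G moving second,
-- she wins G + X in every role in which she wins X, answering each Right move
-- in the component where it was made; symmetrically for Right.  Hence G ≽ 𝟘
-- iff Left wins G moving second, i.e. 𝓟 ≤ₒ o G, and 𝟘 ≽ G iff Right does,
-- i.e. o G ≤ₒ 𝓟 (testing with X = 𝟘 gives the converses).  The corollary's
-- four cases are the four combinations of these two comparisons.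

open import Defs
open import Data.Bool using (Bool; true; false; _∧_; _∨_; not; T)
open import Data.Bool.Properties
  using (∨-assoc; ∧-assoc; ∨-identityʳ; ∧-identityʳ; T-∨; T-∧; ∨-∧-booleanAlgebra)
open import Algebra.Lattice.Properties.BooleanAlgebra ∨-∧-booleanAlgebra
  using (deMorgan₁; deMorgan₂)
open import Data.Empty using (⊥-elim)
open import Data.Product using (_×_; _,_)
import Data.Product as Product
open import Data.Product.Function.NonDependent.Propositional using (_×-⇔_)
open import Data.Sum using (inj₁; inj₂)
import Data.Sum as Sum
open import Data.Unit using (tt)
open import Function.Bundles using (_⇔_; mk⇔; Equivalence)
open import Function.Properties.Equivalence using () renaming (trans to ⇔-trans)
open import Function.Related.TypeIsomorphisms using (¬-cong-⇔)
open import Relation.Binary.PropositionalEquality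
  using (_≡_; refl; sym; trans; cong; cong₂; subst; subst₂)
open import Relation.Nullary using (¬_)

open Equivalence using (to; from)

anyLeftSecond-++ : ∀ xs ys → anyLeftSecond (xs ++ ys) ≡ anyLeftSecond xs ∨ anyLeftSecond ys
anyLeftSecond-++ [ x ] ys = refl
anyLeftSecond-++ (x ∷ xs) ys =
  trans (cong (leftSecond x ∨_) (anyLeftSecond-++ xs ys)) (sym (∨-assoc (leftSecond x) _ _))

allLeftFirst-++ : ∀ xs ys → allLeftFirst (xs ++ ys) ≡ allLeftFirst xs ∧ allLeftFirst ys
allLeftFirst-++ [ x ] ys = refl
allLeftFirst-++ (x ∷ xs) ys =
  trans (cong (leftFirst x ∧_) (allLeftFirst-++ xs ys)) (sym (∧-assoc (leftFirst x) _ _))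

anyRightSecond-++ : ∀ xs ys → anyRightSecond (xs ++ ys) ≡ anyRightSecond xs ∨ anyRightSecond ys
anyRightSecond-++ [ x ] ys = refl
anyRightSecond-++ (x ∷ xs) ys =
  trans (cong (rightSecond x ∨_) (anyRightSecond-++ xs ys)) (sym (∨-assoc (rightSecond x) _ _))

allRightFirst-++ : ∀ xs ys → allRightFirst (xs ++ ys) ≡ allRightFirst xs ∧ allRightFirst ys
allRightFirst-++ [ x ] ys = refl
allRightFirst-++ (x ∷ xs) ys =
  trans (cong (rightFirst x ∧_) (allRightFirst-++ xs ys)) (sym (∧-assoc (rightFirst x) _ _))

anyLeftSecond-++⁺ˡ : ∀ xs {ys} → T (anyLeftSecond xs) → T (anyLeftSecond (xs ++ ys))
anyLeftSecond-++⁺ˡ xs {ys} p = subst T (sym (anyLeftSecond-++ xs ys)) (from T-∨ (inj₁ p))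

anyLeftSecond-++⁺ʳ : ∀ xs {ys} → T (anyLeftSecond ys) → T (anyLeftSecond (xs ++ ys))
anyLeftSecond-++⁺ʳ xs {ys} p = subst T (sym (anyLeftSecond-++ xs ys)) (from T-∨ (inj₂ p))

allLeftFirst-++⁺ : ∀ xs {ys} → T (allLeftFirst xs) → T (allLeftFirst ys) → T (allLeftFirst (xs ++ ys))
allLeftFirst-++⁺ xs {ys} p q = subst T (sym (allLeftFirst-++ xs ys)) (from T-∧ (p , q))

anyRightSecond-++⁺ˡ : ∀ xs {ys} → T (anyRightSecond xs) → T (anyRightSecond (xs ++ ys))
anyRightSecond-++⁺ˡ xs {ys} p = subst T (sym (anyRightSecond-++ xs ys)) (from T-∨ (inj₁ p))

anyRightSecond-++⁺ʳ : ∀ xs {ys} → T (anyRightSecond ys) → T (anyRightSecond (xs ++ ys))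
anyRightSecond-++⁺ʳ xs {ys} p = subst T (sym (anyRightSecond-++ xs ys)) (from T-∨ (inj₂ p))

allRightFirst-++⁺ : ∀ xs {ys} → T (allRightFirst xs) → T (allRightFirst ys) → T (allRightFirst (xs ++ ys))
allRightFirst-++⁺ xs {ys} p q = subst T (sym (allRightFirst-++ xs ys)) (from T-∧ (p , q))

mutual
  rightSecond≡not-leftFirst : ∀ G → rightSecond G ≡ not (leftFirst G)
  rightSecond≡not-leftFirst ∞ = refl
  rightSecond≡not-leftFirst ∞̄ = refl
  rightSecond≡not-leftFirst ⟨ GL ∣ GR ⟩ = allRightFirst≡not-anyLeftSecond GL

  rightFirst≡not-leftSecond : ∀ G → rightFirst G ≡ not (leftSecond G)
  rightFirst≡not-leftSecond ∞ = refl
  rightFirst≡not-leftSecond ∞̄ = refl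
  rightFirst≡not-leftSecond ⟨ GL ∣ GR ⟩ = anyRightSecond≡not-allLeftFirst GR

  allRightFirst≡not-anyLeftSecond : ∀ gs → allRightFirst gs ≡ not (anyLeftSecond gs)
  allRightFirst≡not-anyLeftSecond [ g ] = rightFirst≡not-leftSecond g
  allRightFirst≡not-anyLeftSecond (g ∷ gs) =
    trans (cong₂ _∧_ (rightFirst≡not-leftSecond g) (allRightFirst≡not-anyLeftSecond gs))
          (sym (deMorgan₂ (leftSecond g) _))

  anyRightSecond≡not-allLeftFirst : ∀ gs → anyRightSecond gs ≡ not (allLeftFirst gs)
  anyRightSecond≡not-allLeftFirst [ g ] = rightSecond≡not-leftFirst g
  anyRightSecond≡not-allLeftFirst (g ∷ gs) =
    trans (cong₂ _∨_ (rightSecond≡not-leftFirst g) (anyRightSecond≡not-allLeftFirst gs))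
          (sym (deMorgan₁ (leftFirst g) _))

outcomeˡ : Bool → Bool → Outcome
outcomeˡ true  true  = 𝓛
outcomeˡ true  false = 𝓝
outcomeˡ false true  = 𝓟
outcomeˡ false false = 𝓡

outcomeʳ : Bool → Bool → Outcome
outcomeʳ true  true  = 𝓡
outcomeʳ true  false = 𝓝
outcomeʳ false true  = 𝓟
outcomeʳ false false = 𝓛

o≡outcomeˡ : ∀ G → o G ≡ outcomeˡ (leftFirst G) (leftSecond G)
o≡outcomeˡ G rewrite rightSecond≡not-leftFirst G | rightFirst≡not-leftSecond G
  with leftFirst G | leftSecond G
... | true  | true  = refl
... | true  | false = refl
... | false | true  = refl
... | false | false = refl

o≡outcomeʳ : ∀ G → o G ≡ outcomeʳ (rightFirst G) (rightSecond G)
o≡outcomeʳ G rewrite rightSecond≡not-leftFirst G | rightFirst≡not-leftSecond G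
  with leftFirst G | leftSecond G
... | true  | true  = refl
... | true  | false = refl
... | false | true  = refl
... | false | false = refl

outcomeˡ-mono : ∀ {a b c d} → (T a → T c) → (T b → T d) → outcomeˡ a b ≤ₒ outcomeˡ c d
outcomeˡ-mono {false} {false} _ _ = 𝓡≤
outcomeˡ-mono {c = true} {d = true} _ _ = ≤𝓛
outcomeˡ-mono {true} {c = false} a⇒c _ = ⊥-elim (a⇒c _)
outcomeˡ-mono {b = true} {d = false} _ b⇒d = ⊥-elim (b⇒d _)
outcomeˡ-mono {true} {false} {true} {false} _ _ = refl≤
outcomeˡ-mono {false} {true} {false} {true} _ _ = refl≤

outcomeʳ-antitone : ∀ {a b c d} → (T a → T c) → (T b → T d) → outcomeʳ c d ≤ₒ outcomeʳ a b
outcomeʳ-antitone {false} {false} _ _ = ≤𝓛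
outcomeʳ-antitone {c = true} {d = true} _ _ = 𝓡≤
outcomeʳ-antitone {true} {c = false} a⇒c _ = ⊥-elim (a⇒c _)
outcomeʳ-antitone {b = true} {d = false} _ b⇒d = ⊥-elim (b⇒d _)
outcomeʳ-antitone {true} {false} {true} {false} _ _ = refl≤
outcomeʳ-antitone {false} {true} {false} {true} _ _ = refl≤

𝓟≤outcomeˡ⇒T : ∀ a b → 𝓟 ≤ₒ outcomeˡ a b → T b
𝓟≤outcomeˡ⇒T true  true  _ = _
𝓟≤outcomeˡ⇒T false true  _ = _

outcomeʳ≤𝓟⇒T : ∀ a b → outcomeʳ a b ≤ₒ 𝓟 → T b
outcomeʳ≤𝓟⇒T true  true  _ = _
outcomeʳ≤𝓟⇒T false true  _ = _

mutual
  leftFirst-𝟘+ : ∀ X → leftFirst (𝟘 + X) ≡ leftFirst X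
  leftFirst-𝟘+ ∞ = refl
  leftFirst-𝟘+ ∞̄ = refl
  leftFirst-𝟘+ ⟨ XL ∣ XR ⟩ = anyLeftSecond-𝟘+ XL

  leftSecond-𝟘+ : ∀ X → leftSecond (𝟘 + X) ≡ leftSecond X
  leftSecond-𝟘+ ∞ = refl
  leftSecond-𝟘+ ∞̄ = refl
  leftSecond-𝟘+ ⟨ XL ∣ XR ⟩ = allLeftFirst-𝟘+ XR

  anyLeftSecond-𝟘+ : ∀ xs → anyLeftSecond (addʳ 𝟘 xs) ≡ anyLeftSecond xs
  anyLeftSecond-𝟘+ [ x ] = leftSecond-𝟘+ x
  anyLeftSecond-𝟘+ (x ∷ xs) = cong₂ _∨_ (leftSecond-𝟘+ x) (anyLeftSecond-𝟘+ xs)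

  allLeftFirst-𝟘+ : ∀ xs → allLeftFirst (addʳ 𝟘 xs) ≡ allLeftFirst xs
  allLeftFirst-𝟘+ [ x ] = leftFirst-𝟘+ x
  allLeftFirst-𝟘+ (x ∷ xs) = cong₂ _∧_ (leftFirst-𝟘+ x) (allLeftFirst-𝟘+ xs)

mutual
  leftFirst-+𝟘 : ∀ G → leftFirst (G + 𝟘) ≡ leftFirst G
  leftFirst-+𝟘 ∞ = refl
  leftFirst-+𝟘 ∞̄ = refl
  leftFirst-+𝟘 ⟨ GL ∣ GR ⟩ =
    trans (anyLeftSecond-++ (addˡ GL 𝟘) [ ∞̄ ]) (trans (∨-identityʳ _) (anyLeftSecond-+𝟘 GL))

  leftSecond-+𝟘 : ∀ G → leftSecond (G + 𝟘) ≡ leftSecond G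
  leftSecond-+𝟘 ∞ = refl
  leftSecond-+𝟘 ∞̄ = refl
  leftSecond-+𝟘 ⟨ GL ∣ GR ⟩ =
    trans (allLeftFirst-++ (addˡ GR 𝟘) [ ∞ ]) (trans (∧-identityʳ _) (allLeftFirst-+𝟘 GR))

  anyLeftSecond-+𝟘 : ∀ gs → anyLeftSecond (addˡ gs 𝟘) ≡ anyLeftSecond gs
  anyLeftSecond-+𝟘 [ g ] = leftSecond-+𝟘 g
  anyLeftSecond-+𝟘 (g ∷ gs) = cong₂ _∨_ (leftSecond-+𝟘 g) (anyLeftSecond-+𝟘 gs)

  allLeftFirst-+𝟘 : ∀ gs → allLeftFirst (addˡ gs 𝟘) ≡ allLeftFirst gs
  allLeftFirst-+𝟘 [ g ] = leftFirst-+𝟘 g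
  allLeftFirst-+𝟘 (g ∷ gs) = cong₂ _∧_ (leftFirst-+𝟘 g) (allLeftFirst-+𝟘 gs)

o-𝟘+ : ∀ X → o (𝟘 + X) ≡ o X
o-𝟘+ X = trans (o≡outcomeˡ (𝟘 + X))
  (trans (cong₂ outcomeˡ (leftFirst-𝟘+ X) (leftSecond-𝟘+ X)) (sym (o≡outcomeˡ X)))

o-+𝟘 : ∀ G → o (G + 𝟘) ≡ o G
o-+𝟘 G = trans (o≡outcomeˡ (G + 𝟘))
  (trans (cong₂ outcomeˡ (leftFirst-+𝟘 G) (leftSecond-+𝟘 G)) (sym (o≡outcomeˡ G)))

mutual
  leftSecond-+ : ∀ G X → T (leftSecond G) → T (leftSecond X) → T (leftSecond (G + X))
  leftSecond-+ ∞ X _ _ = _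
  leftSecond-+ ⟨ GL ∣ GR ⟩ ∞ _ _ = _
  leftSecond-+ G@(⟨ GL ∣ GR ⟩) X@(⟨ XL ∣ XR ⟩) g x =
    allLeftFirst-++⁺ (addˡ GR X) (allLeftFirst-addˡ GR X g x) (allLeftFirst-addʳ G XR g x)

  leftFirst-+ʳ : ∀ G X → T (leftSecond G) → T (leftFirst X) → T (leftFirst (G + X))
  leftFirst-+ʳ ∞ X _ _ = _
  leftFirst-+ʳ ⟨ GL ∣ GR ⟩ ∞ _ _ = _
  leftFirst-+ʳ G@(⟨ GL ∣ GR ⟩) X@(⟨ XL ∣ XR ⟩) g x =
    anyLeftSecond-++⁺ʳ (addˡ GL X) (anyLeftSecond-addʳ G XL g x)

  leftFirst-+ˡ : ∀ G X → T (leftFirst G) → T (leftSecond X) → T (leftFirst (G + X))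
  leftFirst-+ˡ ∞ X _ _ = _
  leftFirst-+ˡ ⟨ GL ∣ GR ⟩ ∞ _ _ = _
  leftFirst-+ˡ ⟨ GL ∣ GR ⟩ X@(⟨ XL ∣ XR ⟩) g x =
    anyLeftSecond-++⁺ˡ (addˡ GL X) (anyLeftSecond-addˡ GL X g x)

  anyLeftSecond-addʳ : ∀ G xs → T (leftSecond G) → T (anyLeftSecond xs) → T (anyLeftSecond (addʳ G xs))
  anyLeftSecond-addʳ G [ x ] g h = leftSecond-+ G x g h
  anyLeftSecond-addʳ G (x ∷ xs) g h =
    from T-∨ (Sum.map (leftSecond-+ G x g) (anyLeftSecond-addʳ G xs g) (to T-∨ h))

  anyLeftSecond-addˡ : ∀ gs X → T (anyLeftSecond gs) → T (leftSecond X) → T (anyLeftSecond (addˡ gs X))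
  anyLeftSecond-addˡ [ g ] X h x = leftSecond-+ g X h x
  anyLeftSecond-addˡ (g ∷ gs) X h x =
    from T-∨ (Sum.map (λ p → leftSecond-+ g X p x) (λ p → anyLeftSecond-addˡ gs X p x) (to T-∨ h))

  allLeftFirst-addʳ : ∀ G xs → T (leftSecond G) → T (allLeftFirst xs) → T (allLeftFirst (addʳ G xs))
  allLeftFirst-addʳ G [ x ] g h = leftFirst-+ʳ G x g h
  allLeftFirst-addʳ G (x ∷ xs) g h =
    from T-∧ (Product.map (leftFirst-+ʳ G x g) (allLeftFirst-addʳ G xs g) (to T-∧ h))

  allLeftFirst-addˡ : ∀ gs X → T (allLeftFirst gs) → T (leftSecond X) → T (allLeftFirst (addˡ gs X))
  allLeftFirst-addˡ [ g ] X h x = leftFirst-+ˡ g X h x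
  allLeftFirst-addˡ (g ∷ gs) X h x =
    from T-∧ (Product.map (λ p → leftFirst-+ˡ g X p x) (λ p → allLeftFirst-addˡ gs X p x) (to T-∧ h))

mutual
  rightSecond-+ : ∀ G X → T (rightSecond G) → T (rightSecond X) → T (rightSecond (G + X))
  rightSecond-+ ∞̄ ∞̄ _ _ = _
  rightSecond-+ ∞̄ ⟨ _ ∣ _ ⟩ _ _ = _
  rightSecond-+ ⟨ GL ∣ GR ⟩ ∞̄ _ _ = _
  rightSecond-+ G@(⟨ GL ∣ GR ⟩) X@(⟨ XL ∣ XR ⟩) g x =
    allRightFirst-++⁺ (addˡ GL X) (allRightFirst-addˡ GL X g x) (allRightFirst-addʳ G XL g x)

  rightFirst-+ʳ : ∀ G X → T (rightSecond G) → T (rightFirst X) → T (rightFirst (G + X))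
  rightFirst-+ʳ ∞̄ ∞̄ _ _ = _
  rightFirst-+ʳ ∞̄ ⟨ _ ∣ _ ⟩ _ _ = _
  rightFirst-+ʳ ⟨ GL ∣ GR ⟩ ∞̄ _ _ = _
  rightFirst-+ʳ G@(⟨ GL ∣ GR ⟩) X@(⟨ XL ∣ XR ⟩) g x =
    anyRightSecond-++⁺ʳ (addˡ GR X) (anyRightSecond-addʳ G XR g x)

  rightFirst-+ˡ : ∀ G X → T (rightFirst G) → T (rightSecond X) → T (rightFirst (G + X))
  rightFirst-+ˡ ∞̄ ∞̄ _ _ = _
  rightFirst-+ˡ ∞̄ ⟨ _ ∣ _ ⟩ _ _ = _
  rightFirst-+ˡ ⟨ GL ∣ GR ⟩ ∞̄ _ _ = _
  rightFirst-+ˡ ⟨ GL ∣ GR ⟩ X@(⟨ XL ∣ XR ⟩) g x =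
    anyRightSecond-++⁺ˡ (addˡ GR X) (anyRightSecond-addˡ GR X g x)

  anyRightSecond-addʳ : ∀ G xs → T (rightSecond G) → T (anyRightSecond xs) → T (anyRightSecond (addʳ G xs))
  anyRightSecond-addʳ G [ x ] g h = rightSecond-+ G x g h
  anyRightSecond-addʳ G (x ∷ xs) g h =
    from T-∨ (Sum.map (rightSecond-+ G x g) (anyRightSecond-addʳ G xs g) (to T-∨ h))

  anyRightSecond-addˡ : ∀ gs X → T (anyRightSecond gs) → T (rightSecond X) → T (anyRightSecond (addˡ gs X))
  anyRightSecond-addˡ [ g ] X h x = rightSecond-+ g X h x
  anyRightSecond-addˡ (g ∷ gs) X h x =
    from T-∨ (Sum.map (λ p → rightSecond-+ g X p x) (λ p → anyRightSecond-addˡ gs X p x) (to T-∨ h))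

  allRightFirst-addʳ : ∀ G xs → T (rightSecond G) → T (allRightFirst xs) → T (allRightFirst (addʳ G xs))
  allRightFirst-addʳ G [ x ] g h = rightFirst-+ʳ G x g h
  allRightFirst-addʳ G (x ∷ xs) g h =
    from T-∧ (Product.map (rightFirst-+ʳ G x g) (allRightFirst-addʳ G xs g) (to T-∧ h))

  allRightFirst-addˡ : ∀ gs X → T (allRightFirst gs) → T (rightSecond X) → T (allRightFirst (addˡ gs X))
  allRightFirst-addˡ [ g ] X h x = rightFirst-+ˡ g X h x
  allRightFirst-addˡ (g ∷ gs) X h x =
    from T-∧ (Product.map (λ p → rightFirst-+ˡ g X p x) (λ p → allRightFirst-addˡ gs X p x) (to T-∧ h))

≽𝟘⇔𝓟≤o : ∀ G → (G ≽ 𝟘) ⇔ (𝓟 ≤ₒ o G)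
≽𝟘⇔𝓟≤o G = mk⇔ (λ G≽𝟘 → subst (𝓟 ≤ₒ_) (o-+𝟘 G) (G≽𝟘 𝟘 tt)) ≽𝟘
  where
  ≽𝟘 : 𝓟 ≤ₒ o G → G ≽ 𝟘
  ≽𝟘 𝓟≤oG X _ =
    subst₂ _≤ₒ_ (sym (trans (o-𝟘+ X) (o≡outcomeˡ X))) (sym (o≡outcomeˡ (G + X)))
      (outcomeˡ-mono (leftFirst-+ʳ G X g) (leftSecond-+ G X g))
    where
    g : T (leftSecond G)
    g = 𝓟≤outcomeˡ⇒T _ _ (subst (𝓟 ≤ₒ_) (o≡outcomeˡ G) 𝓟≤oG)

𝟘≽⇔o≤𝓟 : ∀ G → (𝟘 ≽ G) ⇔ (o G ≤ₒ 𝓟)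
𝟘≽⇔o≤𝓟 G = mk⇔ (λ 𝟘≽G → subst (_≤ₒ 𝓟) (o-+𝟘 G) (𝟘≽G 𝟘 tt)) 𝟘≽
  where
  𝟘≽ : o G ≤ₒ 𝓟 → 𝟘 ≽ G
  𝟘≽ oG≤𝓟 X _ =
    subst₂ _≤ₒ_ (sym (o≡outcomeʳ (G + X))) (sym (trans (o-𝟘+ X) (o≡outcomeʳ X)))
      (outcomeʳ-antitone (rightFirst-+ʳ G X r) (rightSecond-+ G X r))
    where
    r : T (rightSecond G)
    r = outcomeʳ≤𝓟⇒T _ _ (subst (_≤ₒ 𝓟) (o≡outcomeʳ G) oG≤𝓟)

outcome-vs-𝓟 : ∀ w →
  ((𝓟 ≤ₒ w × ¬ w ≤ₒ 𝓟) ⇔ (w ≡ 𝓛)) × ((𝓟 ≤ₒ w × w ≤ₒ 𝓟) ⇔ (w ≡ 𝓟)) ×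
  ((¬ 𝓟 ≤ₒ w × ¬ w ≤ₒ 𝓟) ⇔ (w ≡ 𝓝)) × ((w ≤ₒ 𝓟 × ¬ 𝓟 ≤ₒ w) ⇔ (w ≡ 𝓡))
outcome-vs-𝓟 𝓛 =
  mk⇔ (λ _ → refl) (λ _ → ≤𝓛 , λ ()) ,
  mk⇔ (λ { (_ , ()) }) (λ ()) ,
  mk⇔ (λ { (𝓟≰𝓛 , _) → ⊥-elim (𝓟≰𝓛 ≤𝓛) }) (λ ()) ,
  mk⇔ (λ { (() , _) }) (λ ())
outcome-vs-𝓟 𝓟 =
  mk⇔ (λ { (_ , 𝓟≰𝓟) → ⊥-elim (𝓟≰𝓟 refl≤) }) (λ ()) ,
  mk⇔ (λ _ → refl) (λ _ → refl≤ , refl≤) ,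
  mk⇔ (λ { (𝓟≰𝓟 , _) → ⊥-elim (𝓟≰𝓟 refl≤) }) (λ ()) ,
  mk⇔ (λ { (_ , 𝓟≰𝓟) → ⊥-elim (𝓟≰𝓟 refl≤) }) (λ ())
outcome-vs-𝓟 𝓝 =
  mk⇔ (λ { (() , _) }) (λ ()) ,
  mk⇔ (λ { (() , _) }) (λ ()) ,
  mk⇔ (λ _ → refl) (λ _ → (λ ()) , (λ ())) ,
  mk⇔ (λ { (() , _) }) (λ ())
outcome-vs-𝓟 𝓡 =
  mk⇔ (λ { (() , _) }) (λ ()) ,
  mk⇔ (λ { (() , _) }) (λ ()) ,
  mk⇔ (λ { (_ , 𝓡≰𝓟) → ⊥-elim (𝓡≰𝓟 𝓡≤) }) (λ ()) ,
  mk⇔ (λ _ → refl) (λ _ → 𝓡≤ , λ ())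

corollary2p9 : (G : Form) →
    ((G ≻ 𝟘) ⇔ (o G ≡ 𝓛)) × ((G ≈ 𝟘) ⇔ (o G ≡ 𝓟)) ×
    ((G ‖ 𝟘) ⇔ (o G ≡ 𝓝)) × ((G ≺ 𝟘) ⇔ (o G ≡ 𝓡))
corollary2p9 G with outcome-vs-𝓟 (o G)
... | isL , isP , isN , isR =
  ⇔-trans (≽𝟘⇔𝓟≤o G ×-⇔ ¬-cong-⇔ (𝟘≽⇔o≤𝓟 G)) isL ,
  ⇔-trans (≽𝟘⇔𝓟≤o G ×-⇔ 𝟘≽⇔o≤𝓟 G) isP ,
  ⇔-trans (¬-cong-⇔ (≽𝟘⇔𝓟≤o G) ×-⇔ ¬-cong-⇔ (𝟘≽⇔o≤𝓟 G)) isN ,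
  ⇔-trans (𝟘≽⇔o≤𝓟 G ×-⇔ ¬-cong-⇔ (≽𝟘⇔𝓟≤o G)) isR
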